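{- Let $w$ be a p-string with $\Pi_w\neq\emptyset$. If $p<q$ are both prefix periods of $w$, then $2p\le q$.
   Context: Let $\Sigma$ and $\Pi$ be disjoint alphabets; a p-string is a string over $\Sigma\cup\Pi$, indexed from 0, with $w[i:j]=w[i]\cdots w[j-1]$. A permutation $f$ of $\Pi$ acts on p-strings letterwise, fixing letters of $\Sigma$; $x\equiv y$ iff $f(x)=y$ for some permutation $f$ of $\Pi$. For $p\in\mathbb{N}^+$, $p\le|w|$, $p$ is a period of $w$ iff $w[0:|w|-p]\equiv w[p:|w|]$; $\mathrm{period}(w)$ is the smallest period of a nonempty $w$. $\Pi_w$ is the set of parameter characters occurring in $w$. With $k=|\Pi_w|+2$, a positive integer $p$ is a prefix period of $w$ iff there is a prefix $w'$ of $w$ with $\mathrm{period}(w')=p$ and $p\le|w'|/k$. -}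

module Defs where

open import Data.Nat using (ℕ; suc; _+_; _*_; _∸_; _≤_; _<_)
open import Data.List using (List; []; _∷_; length; take; drop; map; deduplicate)
open import Data.Sum using (_⊎_; inj₁; inj₂)
open import Data.Product using (Σ; ∃; ∃-syntax; _×_; _,_)
open import Relation.Binary.PropositionalEquality using (_≡_)
open import Relation.Nullary using (¬_)
open import Relation.Binary.Definitions using (DecidableEquality)
open import Function.Bundles using (_↔_; Inverse)

-- Letters: static alphabet S (Σ) and parameter alphabet P (Π), disjoint via ⊎.
Letter : Set → Set → Set
Letter S P = S ⊎ P

-- p-strings, indexed from 0
PString : Set → Set → Set
PString S P = List (Letter S P)

module _ {S P : Set} where

  -- w[i:j] = w[i] ⋯ w[j-1]
  slice : PString S P → ℕ → ℕ → PString S P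
  slice w i j = take (j ∸ i) (drop i w)

  actL : (P ↔ P) → Letter S P → Letter S P
  actL f (inj₁ a) = inj₁ a
  actL f (inj₂ b) = inj₂ (Inverse.to f b)

  act : (P ↔ P) → PString S P → PString S P
  act f = map (actL f)

  _≈p_ : PString S P → PString S P → Set
  x ≈p y = Σ (P ↔ P) λ f → act f x ≡ y

  IsPeriod : PString S P → ℕ → Set
  IsPeriod w p = (1 ≤ p) × (p ≤ length w)
               × (slice w 0 (length w ∸ p) ≈p slice w p (length w))

  PeriodIs : PString S P → ℕ → Set
  PeriodIs w p = (1 ≤ length w) × IsPeriod w p × (∀ q → IsPeriod w q → p ≤ q)

  params : PString S P → List P
  params [] = []
  params (inj₁ _ ∷ w) = params w
  params (inj₂ b ∷ w) = b ∷ params w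

  numParams : DecidableEquality P → PString S P → ℕ
  numParams _≟_ w = length (deduplicate _≟_ (params w))

  -- p is a prefix period of w (k = |Π_w| + 2)
  IsPrefixPeriod : DecidableEquality P → PString S P → ℕ → Set
  IsPrefixPeriod _≟_ w p =
    ∃[ m ] (m ≤ length w) × PeriodIs (take m w) p
         × (p * (numParams _≟_ w + 2) ≤ m)

  HasParam : PString S P → Set
  HasParam w = ¬ (params w ≡ [])

{-# OPTIONS --safe #-}
-- Suppose q < 2p. Let p be the period of w[0:m) with m ≥ (r+2)p, r = |Π_w|, and q the period
-- of w[0:n). If n ≤ m then p is a period of w[0:n), contradicting the minimality of q. Otherwise
-- w[0:m) has the periods p and q = p + d with 0 < d < p, and we show that d is a period of it
-- too, contradicting the minimality of p. Two p-strings p-match as soon as they have the same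
-- equality pattern and the same static letters, so it suffices to compare the patterns of
-- x ↦ w[x] and x ↦ w[d+x]. For two positions both left of m − q, or both at least p, the
-- permutations F and G witnessing the periods p and q transport one pattern to the other. For a
-- position i < p and a position i′ near the end, follow the orbit of the parameter c = w[i]
-- under F: it has at most r elements, so F^e c = c for some e ≤ r, and w[i′ − ep] = c reduces
-- the comparison to the previous cases, with one more pigeonhole argument when e = r.
module Submission where

open import Data.Empty using (⊥-elim)
open import Data.Fin using (toℕ)
import Data.Fin.Properties as Fin
open import Data.List using (List; []; _∷_; length; take; drop; map; deduplicate; lookup)
open import Data.List.Membership.Propositional using (_∈_)
open import Data.List.Membership.Propositional.Properties using (∈-deduplicate⁺)
open import Data.List.Properties using (length-take)
open import Data.List.Relation.Unary.Any using (index; here; there)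
open import Data.List.Relation.Unary.Any.Properties using (lookup-index)
open import Data.Maybe using (Maybe; just; nothing; fromMaybe)
import Data.Maybe as Maybe
open import Data.Maybe.Properties using (just-injective)
open import Data.Nat using (ℕ; zero; suc; _+_; _*_; _∸_; _≤_; _<_; z≤n; s≤s; >-nonZero)
open import Data.Nat.Properties
open import Algebra.Properties.CommutativeSemigroup +-commutativeSemigroup using (x∙yz≈y∙xz; xy∙z≈y∙xz)
open import Data.Nat.Tactic.RingSolver using (solve-∀)
open import Data.Product using (∃₂; ∃-syntax; _×_; _,_; map₂; proj₁; proj₂)
open import Data.Sum using (inj₁; inj₂)
open import Data.Sum.Properties using (inj₂-injective)
open import Function using (_∘_; case_of_)
open import Function.Bundles using (_↔_; _⇔_; mk⇔; mk↔ₛ′; Equivalence; Inverse; Injection)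
open import Function.Construct.Composition using (_↔-∘_; _⇔-∘_)
open import Function.Construct.Identity using (↔-id)
open import Function.Construct.Symmetry using (⇔-sym)
open import Function.Properties.Inverse using (↔⇒↣)
open import Relation.Binary.Definitions using (DecidableEquality)
open import Relation.Binary.PropositionalEquality
open import Relation.Nullary using (yes; no; contradiction)

open import Defs

open Inverse using (to)

+<⇒<∸ : ∀ {p x n} → p + x < n → x < n ∸ p
+<⇒<∸ {p} {x} {n} h = m+n≤o⇒m≤o∸n (suc x) (subst (_< n) (+-comm p x) h)

<∸⇒+< : ∀ {p x n} → x < n ∸ p → p + x < n
<∸⇒+< {p} {x} {n} h = subst (_< n) (+-comm x p) (m≤o∸n⇒m+n≤o (suc x) p≤n h)
  where
    p≤n : p ≤ n
    p≤n = <⇒≤ (m∸n≢0⇒n<m λ n∸p≡0 → contradiction (subst (x <_) n∸p≡0 h) λ ())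

≤⇒∃+ : ∀ {p x} → p ≤ x → ∃[ k ] p + k ≡ x
≤⇒∃+ {p} {x} p≤x = x ∸ p , m+[n∸m]≡n p≤x

≡⇔≡-flip : ∀ {A B : Set} {a b : A} {c d : B} → (a ≡ b ⇔ c ≡ d) → (b ≡ a ⇔ d ≡ c)
≡⇔≡-flip a≡b⇔c≡d = mk⇔ (λ b≡a → sym (Equivalence.to a≡b⇔c≡d (sym b≡a)))
                         (λ d≡c → sym (Equivalence.from a≡b⇔c≡d (sym d≡c)))

at : {A : Set} → List A → ℕ → Maybe A
at []       _       = nothing
at (x ∷ xs) zero    = just x
at (x ∷ xs) (suc i) = at xs i

at-map : {A B : Set} (f : A → B) (xs : List A) (i : ℕ) → at (map f xs) i ≡ Maybe.map f (at xs i)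
at-map f []       i       = refl
at-map f (x ∷ xs) zero    = refl
at-map f (x ∷ xs) (suc i) = at-map f xs i

module _ {A : Set} where

  at-take : ∀ (xs : List A) {n i} → i < n → at (take n xs) i ≡ at xs i
  at-take []       {suc n} {i}     _         = refl
  at-take (x ∷ xs) {suc n} {zero}  _         = refl
  at-take (x ∷ xs) {suc n} {suc i} (s≤s i<n) = at-take xs i<n

  at-take-≥ : ∀ (xs : List A) {n i} → n ≤ i → at (take n xs) i ≡ nothing
  at-take-≥ []       {zero}          _         = refl
  at-take-≥ []       {suc n}         _         = refl
  at-take-≥ (x ∷ xs) {zero}          _         = refl
  at-take-≥ (x ∷ xs) {suc n} {suc i} (s≤s n≤i) = at-take-≥ xs n≤i

  at-drop : ∀ (xs : List A) n i → at (drop n xs) i ≡ at xs (n + i)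
  at-drop []       zero    i = refl
  at-drop []       (suc n) i = refl
  at-drop (x ∷ xs) zero    i = refl
  at-drop (x ∷ xs) (suc n) i = at-drop xs n i

  at-extensional : ∀ (xs ys : List A) → (∀ i → at xs i ≡ at ys i) → xs ≡ ys
  at-extensional []       []       _  = refl
  at-extensional []       (y ∷ ys) eq with () ← eq 0
  at-extensional (x ∷ xs) []       eq with () ← eq 0
  at-extensional (x ∷ xs) (y ∷ ys) eq =
    cong₂ _∷_ (just-injective (eq 0)) (at-extensional xs ys (λ i → eq (suc i)))

  lookupOr : A → List A → ℕ → A
  lookupOr default xs i = fromMaybe default (at xs i)

  at-< : ∀ (default : A) (xs : List A) {i} → i < length xs → at xs i ≡ just (lookupOr default xs i)
  at-< d (x ∷ xs) {zero}  _         = refl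
  at-< d (x ∷ xs) {suc i} (s≤s i<n) = at-< d xs i<n

  map-take≡take-drop⇔ : ∀ (f : A → A) u p →
    map f (take (length u ∸ p) u) ≡ take (length u ∸ p) (drop p u) ⇔
    (∀ x → p + x < length u → Maybe.map f (at u x) ≡ at u (p + x))
  map-take≡take-drop⇔ f u p = mk⇔
    (λ eq x h → trans (sym (at-lhs (+<⇒<∸ h))) (trans (cong (λ v → at v x) eq) (at-rhs (+<⇒<∸ h))))
    (λ shifted → at-extensional _ _ λ x → case x <? L of λ where
      (yes x<L) → trans (at-lhs x<L) (trans (shifted x (<∸⇒+< x<L)) (sym (at-rhs x<L)))
      (no  x≮L) → trans (at-map f (take L u) x)
                    (trans (cong (Maybe.map f) (at-take-≥ u (≮⇒≥ x≮L)))
                           (sym (at-take-≥ (drop p u) (≮⇒≥ x≮L)))))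
    where
      L : ℕ
      L = length u ∸ p
      at-lhs : ∀ {x} → x < L → at (map f (take L u)) x ≡ Maybe.map f (at u x)
      at-lhs {x} x<L = trans (at-map f (take L u) x) (cong (Maybe.map f) (at-take u x<L))
      at-rhs : ∀ {x} → x < L → at (take L (drop p u)) x ≡ at u (p + x)
      at-rhs {x} x<L = trans (at-take (drop p u) x<L) (at-drop u p x)

pigeonhole : ∀ {A : Set} (D : List A) {k} (h : ℕ → A) → length D < k → (∀ t → t < k → h t ∈ D) →
             ∃₂ λ s t → s < t × t < k × h s ≡ h t
pigeonhole D h |D|<k h∈D
  with i , j , i<j , eq ← Fin.pigeonhole |D|<k (λ t → index (h∈D (toℕ t) (Fin.toℕ<n t)))
  = toℕ i , toℕ j , i<j , Fin.toℕ<n j , index-injective (h∈D _ _) (h∈D _ _) eq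
  where
    index-injective : ∀ {x y} (x∈D : x ∈ D) (y∈D : y ∈ D) → index x∈D ≡ index y∈D → x ≡ y
    index-injective x∈D y∈D eq =
      trans (lookup-index x∈D) (trans (cong (lookup D) eq) (sym (lookup-index y∈D)))

module _ {P : Set} where

  to-injective : (F : P ↔ P) {a b : P} → to F a ≡ to F b → a ≡ b
  to-injective F = Injection.injective (↔⇒↣ F)

  _^_ : P ↔ P → ℕ → P ↔ P
  F ^ zero  = ↔-id P
  F ^ suc t = F ↔-∘ (F ^ t)

  ^-+ : ∀ (F : P ↔ P) t e a → to (F ^ (t + e)) a ≡ to (F ^ t) (to (F ^ e) a)
  ^-+ F zero    e a = refl
  ^-+ F (suc t) e a = cong (to F) (^-+ F t e a)

  ^-comm : ∀ (F : P ↔ P) t e a → to (F ^ t) (to (F ^ e) a) ≡ to (F ^ e) (to (F ^ t) a)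
  ^-comm F t e a = begin
    to (F ^ t) (to (F ^ e) a)  ≡⟨ ^-+ F t e a ⟨
    to (F ^ (t + e)) a         ≡⟨ cong (λ k → to (F ^ k) a) (+-comm t e) ⟩
    to (F ^ (e + t)) a         ≡⟨ ^-+ F e t a ⟩
    to (F ^ e) (to (F ^ t) a)  ∎
    where open ≡-Reasoning

  ^-∸ : ∀ (F : P ↔ P) {s t} a → s < t → to (F ^ s) a ≡ to (F ^ t) a → to (F ^ (t ∸ s)) a ≡ a
  ^-∸ F {s} {t} a s<t eq = sym (to-injective (F ^ s) (begin
    to (F ^ s) a                     ≡⟨ eq ⟩
    to (F ^ t) a                     ≡⟨ cong (λ k → to (F ^ k) a) (m+[n∸m]≡n (<⇒≤ s<t)) ⟨
    to (F ^ (s + (t ∸ s))) a         ≡⟨ ^-+ F s (t ∸ s) a ⟩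
    to (F ^ s) (to (F ^ (t ∸ s)) a)  ∎))
    where open ≡-Reasoning

  orbit-returns : ∀ (F : P ↔ P) (D : List P) {k} a → length D < k →
                  (∀ t → t < k → to (F ^ t) a ∈ D) → ∃[ e ] 1 ≤ e × e < k × to (F ^ e) a ≡ a
  orbit-returns F D a |D|<k orbit∈D
    with s , t , s<t , t<k , eq ← pigeonhole D (λ t → to (F ^ t) a) |D|<k orbit∈D
    = t ∸ s , m<n⇒0<n∸m s<t , ≤-<-trans (m∸n≤m t s) t<k , ^-∸ F a s<t eq

module _ {P : Set} (_≟_ : DecidableEquality P) where

  swap : P → P → P → P
  swap a b x with x ≟ a | x ≟ b
  ... | yes _ | _     = b
  ... | no  _ | yes _ = a
  ... | no  _ | no  _ = x

  swap-left : ∀ a b → swap a b a ≡ b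
  swap-left a b with a ≟ a
  ... | yes _   = refl
  ... | no  a≢a = contradiction refl a≢a

  swap-right : ∀ a b → swap a b b ≡ a
  swap-right a b with b ≟ a | b ≟ b
  ... | yes b≡a | _       = b≡a
  ... | no  _   | yes _   = refl
  ... | no  _   | no  b≢b = contradiction refl b≢b

  swap-other : ∀ {a b x} → x ≢ a → x ≢ b → swap a b x ≡ x
  swap-other {a} {b} {x} x≢a x≢b with x ≟ a | x ≟ b
  ... | yes x≡a | _       = contradiction x≡a x≢a
  ... | no  _   | yes x≡b = contradiction x≡b x≢b
  ... | no  _   | no  _   = refl

  swap-involutive : ∀ a b x → swap a b (swap a b x) ≡ x
  swap-involutive a b x with x ≟ a | x ≟ b
  ... | yes refl | _        = swap-right x b
  ... | no  _    | yes refl = swap-left a x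
  ... | no  x≢a  | no  x≢b  = swap-other x≢a x≢b

  transposition : P → P → P ↔ P
  transposition a b = mk↔ₛ′ (swap a b) (swap a b) (swap-involutive a b) (swap-involutive a b)

module _ {S P : Set} where

  actL-injective : (F : P ↔ P) {a b : Letter S P} → actL F a ≡ actL F b → a ≡ b
  actL-injective F {inj₁ _} {inj₁ _} eq = eq
  actL-injective F {inj₂ _} {inj₂ _} eq = cong inj₂ (to-injective F (inj₂-injective eq))

  actL-id : ∀ (a : Letter S P) → actL (↔-id P) a ≡ a
  actL-id (inj₁ _) = refl
  actL-id (inj₂ _) = refl

  actL-∘ : ∀ (F G : P ↔ P) (a : Letter S P) → actL (F ↔-∘ G) a ≡ actL F (actL G a)
  actL-∘ F G (inj₁ _) = refl
  actL-∘ F G (inj₂ _) = refl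

  actL-≡⇔ : ∀ (F : P ↔ P) {a b a′ b′ : Letter S P} →
            actL F a ≡ a′ → actL F b ≡ b′ → (a ≡ b ⇔ a′ ≡ b′)
  actL-≡⇔ F refl refl = mk⇔ (cong (actL F)) (actL-injective F)

  actL-inj₁⇔ : ∀ (F : P ↔ P) {a a′ : Letter S P} {z} → actL F a ≡ a′ → (a ≡ inj₁ z ⇔ a′ ≡ inj₁ z)
  actL-inj₁⇔ F refl = mk⇔ (λ { refl → refl }) (reflect _)
    where
      reflect : ∀ a {z} → actL F a ≡ inj₁ z → a ≡ inj₁ z
      reflect (inj₁ _) eq = eq

  actL-transposition-other : ∀ (_≟_ : DecidableEquality P) {a b} (y : Letter S P) →
                             y ≢ inj₂ a → y ≢ inj₂ b → actL (transposition _≟_ a b) y ≡ y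
  actL-transposition-other _≟_ (inj₁ _) _   _   = refl
  actL-transposition-other _≟_ (inj₂ c) c≢a c≢b =
    cong inj₂ (swap-other _≟_ (c≢a ∘ cong inj₂) (c≢b ∘ cong inj₂))

  -- Shifted F p u v n: F carries u x to v (p + x) whenever p + x < n. So Shifted F p s s n says
  -- that F witnesses the period p of s[0:n), and Shifted F 0 u v n that u[0:n) ≈p v[0:n).
  Shifted : (P ↔ P) → ℕ → (ℕ → Letter S P) → (ℕ → Letter S P) → ℕ → Set
  Shifted F p u v n = ∀ x → p + x < n → actL F (u x) ≡ v (p + x)

  Periodic : (ℕ → Letter S P) → ℕ → ℕ → Set
  Periodic s n p = 1 ≤ p × p ≤ n × ∃[ F ] Shifted F p s s n

  MinimalPeriod : (ℕ → Letter S P) → ℕ → ℕ → Set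
  MinimalPeriod s n p = Periodic s n p × (∀ q → Periodic s n q → p ≤ q)

  SamePattern : (ℕ → Letter S P) → (ℕ → Letter S P) → ℕ → Set
  SamePattern u v n =
    (∀ {x y} → x < n → y < n → (u x ≡ u y ⇔ v x ≡ v y)) ×
    (∀ {x z} → x < n → (u x ≡ inj₁ z ⇔ v x ≡ inj₁ z))

  ParamsIn : List P → (ℕ → Letter S P) → ℕ → Set
  ParamsIn D s n = ∀ {x a} → x < n → s x ≡ inj₂ a → a ∈ D

  Periodic-restrict : ∀ {s : ℕ → Letter S P} {m n p} → p ≤ m → m ≤ n → Periodic s n p → Periodic s m p
  Periodic-restrict p≤m m≤n (1≤p , _ , F , shifted) = 1≤p , p≤m , F , λ x h → shifted x (<-≤-trans h m≤n)

  Shifted-iterate : ∀ {F : P ↔ P} {p s n} → Shifted F p s s n →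
                    ∀ t x → t * p + x < n → actL (F ^ t) (s x) ≡ s (t * p + x)
  Shifted-iterate                 period zero    x _ = actL-id _
  Shifted-iterate {F} {p} {s} {n} period (suc t) x h = begin
    actL (F ↔-∘ (F ^ t)) (s x)   ≡⟨ actL-∘ F (F ^ t) (s x) ⟩
    actL F (actL (F ^ t) (s x))  ≡⟨ cong (actL F) (Shifted-iterate period t x (≤-<-trans (m≤n+m _ p) h′)) ⟩
    actL F (s (t * p + x))       ≡⟨ period (t * p + x) h′ ⟩
    s (p + (t * p + x))          ≡⟨ cong s (+-assoc p (t * p) x) ⟨
    s (p + t * p + x)            ∎
    where
      open ≡-Reasoning
      h′ : p + (t * p + x) < n
      h′ = subst (_< n) (+-assoc p (t * p) x) h

  Shifted-snoc : ∀ {H : P ↔ P} {u v k} →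
                 Shifted H 0 u v k → actL H (u k) ≡ v k → Shifted H 0 u v (suc k)
  Shifted-snoc old new x x<1+k with m<1+n⇒m<n∨m≡n x<1+k
  ... | inj₁ x<k  = old x x<k
  ... | inj₂ refl = new

module _ {S P : Set} (w : PString S P) (default : Letter S P) where

  at-take-lookupOr : ∀ {m x} → m ≤ length w → x < m → at (take m w) x ≡ just (lookupOr default w x)
  at-take-lookupOr m≤|w| x<m = trans (at-take w x<m) (at-< default w (<-≤-trans x<m m≤|w|))

  IsPeriod-take⇔Periodic : ∀ {m p} → m ≤ length w →
                           IsPeriod (take m w) p ⇔ Periodic (lookupOr default w) m p
  IsPeriod-take⇔Periodic {m} {p} m≤|w| = mk⇔
    (λ (1≤p , p≤|u| , F , eq) →
      1≤p , subst (p ≤_) |u|≡m p≤|u| , F , Equivalence.to (matches⇔ F) eq)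
    (λ (1≤p , p≤m , F , shifted) →
      1≤p , subst (p ≤_) (sym |u|≡m) p≤m , F , Equivalence.from (matches⇔ F) shifted)
    where
      s : ℕ → Letter S P
      s = lookupOr default w
      u : PString S P
      u = take m w

      |u|≡m : length u ≡ m
      |u|≡m = trans (length-take m w) (m≤n⇒m⊓n≡m m≤|w|)

      at-shift⇔ : ∀ F {x} → p + x < m →
                  (Maybe.map (actL F) (at u x) ≡ at u (p + x) ⇔ actL F (s x) ≡ s (p + x))
      at-shift⇔ F {x} h rewrite at-take-lookupOr m≤|w| (≤-<-trans (m≤n+m x p) h) | at-take-lookupOr m≤|w| h =
        mk⇔ just-injective (cong just)

      matches⇔ : ∀ F →
                 (act F (take (length u ∸ p) u) ≡ take (length u ∸ p) (drop p u) ⇔ Shifted F p s s m)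
      matches⇔ F = mk⇔
        (λ h x p+x<m → Equivalence.to (at-shift⇔ F p+x<m) (h x (subst (p + x <_) (sym |u|≡m) p+x<m)))
        (λ shifted x p+x<|u| → let p+x<m = subst (p + x <_) |u|≡m p+x<|u| in
          Equivalence.from (at-shift⇔ F p+x<m) (shifted x p+x<m))
        ⇔-∘ map-take≡take-drop⇔ (actL F) u p

  PeriodIs-take⇒MinimalPeriod : ∀ {m p} → m ≤ length w → PeriodIs (take m w) p →
                                MinimalPeriod (lookupOr default w) m p
  PeriodIs-take⇒MinimalPeriod m≤|w| (_ , period , minimal) =
    Equivalence.to (IsPeriod-take⇔Periodic m≤|w|) period ,
    λ q periodic → minimal q (Equivalence.from (IsPeriod-take⇔Periodic m≤|w|) periodic)

  ∈-params : ∀ {x a} → x < length w → lookupOr default w x ≡ inj₂ a → a ∈ params w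
  ∈-params x<|w| wx≡a = at-∈-params w (trans (at-< default w x<|w|) (cong just wx≡a))
    where
      at-∈-params : ∀ (v : PString S P) {x a} → at v x ≡ just (inj₂ a) → a ∈ params v
      at-∈-params (inj₂ _ ∷ v) {zero}  refl = here refl
      at-∈-params (inj₁ _ ∷ v) {suc x} eq   = at-∈-params v eq
      at-∈-params (inj₂ _ ∷ v) {suc x} eq   = there (at-∈-params v eq)

module _ {S P : Set} (_≟_ : DecidableEquality P) {u v : ℕ → Letter S P} {n : ℕ}
         (same : SamePattern u v n) where

  matching-extend : ∀ {k} H → k < n → Shifted H 0 u v k → ∃[ H′ ] Shifted H′ 0 u v (suc k)
  matching-extend {k} H k<n old with u k in uk | v k in vk
  ... | inj₁ z | _      =
    H , Shifted-snoc old (trans (cong (actL H) uk) (sym (Equivalence.to (proj₂ same k<n) uk)))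
  ... | inj₂ a | inj₁ z = contradiction (trans (sym uk) (Equivalence.from (proj₂ same k<n) vk)) λ ()
  ... | inj₂ a | inj₂ b with to H a ≟ b
  ...   | yes Ha≡b =
    H , Shifted-snoc old (trans (cong (actL H) uk) (trans (cong inj₂ Ha≡b) (sym vk)))
  ...   | no  Ha≢b = τ ↔-∘ H , Shifted-snoc old′ new
    where
      τ : P ↔ P
      τ = transposition _≟_ (to H a) b
      new : actL (τ ↔-∘ H) (u k) ≡ v k
      new = trans (cong (actL (τ ↔-∘ H)) uk) (trans (cong inj₂ (swap-left _≟_ (to H a) b)) (sym vk))
      old′ : Shifted (τ ↔-∘ H) 0 u v k
      old′ x x<k = begin
        actL (τ ↔-∘ H) (u x)   ≡⟨ actL-∘ τ H (u x) ⟩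
        actL τ (actL H (u x))  ≡⟨ cong (actL τ) (old x x<k) ⟩
        actL τ (v x)           ≡⟨ actL-transposition-other _≟_ (v x) vx≢Ha vx≢b ⟩
        v x                    ∎
        where
          open ≡-Reasoning
          x<n : x < n
          x<n = <-trans x<k k<n
          ux≢uk : u x ≢ u k
          ux≢uk eq = Ha≢b (inj₂-injective (begin
            inj₂ (to H a)  ≡⟨ cong (actL H) uk ⟨
            actL H (u k)   ≡⟨ cong (actL H) eq ⟨
            actL H (u x)   ≡⟨ old x x<k ⟩
            v x            ≡⟨ Equivalence.to (proj₁ same x<n k<n) eq ⟩
            v k            ≡⟨ vk ⟩
            inj₂ b         ∎))
          vx≢Ha : v x ≢ inj₂ (to H a)
          vx≢Ha eq = ux≢uk (actL-injective H (trans (old x x<k) (trans eq (sym (cong (actL H) uk)))))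
          vx≢b : v x ≢ inj₂ b
          vx≢b eq = ux≢uk (Equivalence.from (proj₁ same x<n k<n) (trans eq (sym vk)))

  samePattern⇒matching : ∃[ H ] Shifted H 0 u v n
  samePattern⇒matching = matching-below n ≤-refl
    where
      matching-below : ∀ k → k ≤ n → ∃[ H ] Shifted H 0 u v k
      matching-below zero    _   = ↔-id P , λ _ ()
      matching-below (suc k) k<n with H , H-matches ← matching-below k (<⇒≤ k<n) =
        matching-extend H k<n H-matches

module Orbit {S P : Set} {F : P ↔ P} {α β : ℕ → Letter S P} {p n : ℕ} {D : List P}
  (α-period : Shifted F p α α n) (β-period : Shifted F p β β n)
  (α∈D : ParamsIn D α n) (β∈D : ParamsIn D β n)
  (1≤r : 1 ≤ length D) (bound : length D * p + p ≤ n)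
  (agree-left : ∀ {x y} → p + x < n → p + y < n → α x ≡ α y → β x ≡ β y)
  (agree-right : ∀ {x y} → p ≤ x → p ≤ y → x < n → y < n → α x ≡ α y → β x ≡ β y)
  (agree-inj₁ : ∀ {x z} → x < n → α x ≡ inj₁ z → β x ≡ inj₁ z)
  where

  r : ℕ
  r = length D

  p≤rp : p ≤ r * p
  p≤rp = m≤n*m p r {{>-nonZero 1≤r}}

  p≤n : p ≤ n
  p≤n = ≤-trans (m≤n+m p (r * p)) bound

  module Parameter {i i′ c} (i<p : i < p) (rp≤i′ : r * p ≤ i′) (i′<n : i′ < n)
                   (αi : α i ≡ inj₂ c) (αi′ : α i′ ≡ inj₂ c) where

    orbit : ℕ → P
    orbit t = to (F ^ t) c

    tp+i<n : ∀ {t} → t ≤ r → t * p + i < n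
    tp+i<n {t} t≤r = begin-strict
      t * p + i  <⟨ +-monoʳ-< (t * p) i<p ⟩
      t * p + p  ≤⟨ +-monoˡ-≤ p (*-monoˡ-≤ p t≤r) ⟩
      r * p + p  ≤⟨ bound ⟩
      n          ∎
      where open ≤-Reasoning

    orbit∈D : ∀ t → t < suc r → orbit t ∈ D
    orbit∈D t t<1+r = α∈D (tp+i<n t≤r)
      (trans (sym (Shifted-iterate α-period t i (tp+i<n t≤r))) (cong (actL (F ^ t)) αi))
      where
        t≤r : t ≤ r
        t≤r = m<1+n⇒m≤n t<1+r

    p+i<n : p + i < n
    p+i<n = begin-strict
      p + i      <⟨ +-monoʳ-< p i<p ⟩
      p + p      ≤⟨ +-monoˡ-≤ p p≤rp ⟩
      r * p + p  ≤⟨ bound ⟩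
      n          ∎
      where open ≤-Reasoning

    module Return {e} (1≤e : 1 ≤ e) (e≤r : e ≤ r) (return : orbit e ≡ c) where

      j : ℕ
      j = i′ ∸ e * p

      ep+j≡i′ : e * p + j ≡ i′
      ep+j≡i′ = m+[n∸m]≡n (≤-trans (*-monoˡ-≤ p e≤r) rp≤i′)

      ep+j<n : e * p + j < n
      ep+j<n = subst (_< n) (sym ep+j≡i′) i′<n

      p+j<n : p + j < n
      p+j<n = ≤-<-trans (+-monoˡ-≤ j (m≤n*m p e {{>-nonZero 1≤e}})) ep+j<n

      αj : α j ≡ inj₂ c
      αj = actL-injective (F ^ e) (begin
        actL (F ^ e) (α j)  ≡⟨ Shifted-iterate α-period e j ep+j<n ⟩
        α (e * p + j)       ≡⟨ cong α ep+j≡i′ ⟩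
        α i′                ≡⟨ αi′ ⟩
        inj₂ c              ≡⟨ cong inj₂ return ⟨
        inj₂ (orbit e)      ∎)
        where open ≡-Reasoning

      βi≡βj : β i ≡ β j
      βi≡βj = agree-left p+i<n p+j<n (trans αi (sym αj))

      agree-via-right : p ≤ j → β i ≡ β i′
      agree-via-right p≤j = trans βi≡βj
        (agree-right p≤j (≤-trans p≤rp rp≤i′) (≤-<-trans (m≤n+m j p) p+j<n) i′<n (trans αj (sym αi′)))

      agree-via-fixed : actL (F ^ e) (β j) ≡ β j → β i ≡ β i′
      agree-via-fixed fixed = begin
        β i                 ≡⟨ βi≡βj ⟩
        β j                 ≡⟨ fixed ⟨
        actL (F ^ e) (β j)  ≡⟨ Shifted-iterate β-period e j ep+j<n ⟩
        β (e * p + j)       ≡⟨ cong β ep+j≡i′ ⟩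
        β i′                ∎
        where open ≡-Reasoning

    module _ {e} (1≤e : 1 ≤ e) (e≤r : e ≤ r) (return : orbit e ≡ c) where
      open Return 1≤e e≤r return

      orbit-fixed : ∀ t → to (F ^ e) (orbit t) ≡ orbit t
      orbit-fixed t = trans (^-comm F e t c) (cong (to (F ^ t)) return)

      candidates : P → ℕ → P
      candidates ℓ zero    = ℓ
      candidates ℓ (suc t) = orbit t

      candidates∈D : ∀ {ℓ} → β j ≡ inj₂ ℓ → ∀ t → t < suc r → candidates ℓ t ∈ D
      candidates∈D βj zero    _         = β∈D (≤-<-trans (m≤n+m j p) p+j<n) βj
      candidates∈D βj (suc t) (s≤s t<r) = orbit∈D t (m<n⇒m<1+n t<r)

      -- Among the r + 1 letters β j, c, F c, …, F^(r−1) c of D two coincide: either β j lies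
      -- on the orbit of c, so F^e fixes it, or the orbit closes after e′ < r steps, and then
      -- j′ = i′ − e′p ≥ p.
      agree-after-return : β i ≡ β i′
      agree-after-return with β j in βj
      ... | inj₁ z = agree-via-fixed (trans (cong (actL (F ^ e)) βj) (sym βj))
      ... | inj₂ ℓ with pigeonhole D (candidates ℓ) ≤-refl (candidates∈D βj)
      ...   | zero  , suc t , _ , _ , refl =
              agree-via-fixed (trans (cong (actL (F ^ e)) βj) (trans (cong inj₂ (orbit-fixed t)) (sym βj)))
      ...   | suc s , suc t , s≤s s<t , s≤s t<r , eq =
              Return.agree-via-right (m<n⇒0<n∸m s<t) (≤-trans (m∸n≤m t s) (<⇒≤ t<r)) (^-∸ F c s<t eq)
                (m+n≤o⇒m≤o∸n p (≤-trans (*-monoˡ-≤ p (≤-trans (s≤s (m∸n≤m t s)) t<r)) rp≤i′))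

    agree : β i ≡ β i′
    agree with e , 1≤e , e<1+r , return ← orbit-returns F D c ≤-refl orbit∈D
      = agree-after-return 1≤e (m<1+n⇒m≤n e<1+r) return

  agree-mixed : ∀ {i i′} → i < p → r * p ≤ i′ → i′ < n → α i ≡ α i′ → β i ≡ β i′
  agree-mixed {i} i<p rp≤i′ i′<n αi≡αi′ with α i in αi
  ... | inj₁ z = trans (agree-inj₁ (<-≤-trans i<p p≤n) αi) (sym (agree-inj₁ i′<n (sym αi≡αi′)))
  ... | inj₂ c = Parameter.agree i<p rp≤i′ i′<n αi (sym αi≡αi′)

module CommonPeriod {S P : Set} {F G : P ↔ P} {α β : ℕ → Letter S P} {p n : ℕ} {D : List P}
  (α-period : Shifted F p α α n) (β-period : Shifted F p β β n) (αβ-shift : Shifted G p α β n)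
  (α∈D : ParamsIn D α n) (β∈D : ParamsIn D β n)
  (1≤r : 1 ≤ length D) (bound : length D * p + p ≤ n)
  where

  r : ℕ
  r = length D

  far⇒p≤ : ∀ {x} → n ≤ p + x → p ≤ x
  far⇒p≤ {x} n≤p+x = +-cancelˡ-≤ p p x (begin
    p + p      ≤⟨ +-monoˡ-≤ p (m≤n*m p r {{>-nonZero 1≤r}}) ⟩
    r * p + p  ≤⟨ bound ⟩
    n          ≤⟨ n≤p+x ⟩
    p + x      ∎)
    where open ≤-Reasoning

  agree-left : ∀ {x y} → p + x < n → p + y < n → (α x ≡ α y ⇔ β x ≡ β y)
  agree-left {x} {y} hx hy =
    ⇔-sym (actL-≡⇔ F (β-period x hx) (β-period y hy)) ⇔-∘ actL-≡⇔ G (αβ-shift x hx) (αβ-shift y hy)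

  agree-right : ∀ {x y} → p ≤ x → p ≤ y → x < n → y < n → (α x ≡ α y ⇔ β x ≡ β y)
  agree-right p≤x p≤y x<n y<n with x , refl ← ≤⇒∃+ p≤x | y , refl ← ≤⇒∃+ p≤y =
    actL-≡⇔ G (αβ-shift x x<n) (αβ-shift y y<n) ⇔-∘ ⇔-sym (actL-≡⇔ F (α-period x x<n) (α-period y y<n))

  agree-inj₁ : ∀ {x z} → x < n → (α x ≡ inj₁ z ⇔ β x ≡ inj₁ z)
  agree-inj₁ {x} x<n with p + x <? n
  ... | yes h = ⇔-sym (actL-inj₁⇔ F (β-period x h)) ⇔-∘ actL-inj₁⇔ G (αβ-shift x h)
  ... | no  h with x , refl ← ≤⇒∃+ (far⇒p≤ (≮⇒≥ h)) =
    actL-inj₁⇔ G (αβ-shift x x<n) ⇔-∘ ⇔-sym (actL-inj₁⇔ F (α-period x x<n))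

  module Forward = Orbit α-period β-period α∈D β∈D 1≤r bound
    (λ hx hy → Equivalence.to (agree-left hx hy))
    (λ p≤x p≤y x<n y<n → Equivalence.to (agree-right p≤x p≤y x<n y<n))
    (λ x<n → Equivalence.to (agree-inj₁ x<n))

  module Backward = Orbit β-period α-period β∈D α∈D 1≤r bound
    (λ hx hy → Equivalence.from (agree-left hx hy))
    (λ p≤x p≤y x<n y<n → Equivalence.from (agree-right p≤x p≤y x<n y<n))
    (λ x<n → Equivalence.from (agree-inj₁ x<n))

  agree-far : ∀ {x y} → n ≤ p + y → x < n → y < n → (α x ≡ α y ⇔ β x ≡ β y)
  agree-far {x} {y} n≤p+y x<n y<n with x <? p
  ... | yes x<p = mk⇔ (Forward.agree-mixed x<p rp≤y y<n) (Backward.agree-mixed x<p rp≤y y<n)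
    where
      rp≤y : r * p ≤ y
      rp≤y = +-cancelʳ-≤ p (r * p) y (≤-trans bound (subst (n ≤_) (+-comm p y) n≤p+y))
  ... | no  x≮p = agree-right (≮⇒≥ x≮p) (far⇒p≤ n≤p+y) x<n y<n

  samePattern : SamePattern α β n
  samePattern = agree , agree-inj₁
    where
      agree : ∀ {x y} → x < n → y < n → (α x ≡ α y ⇔ β x ≡ β y)
      agree {x} {y} x<n y<n with p + x <? n | p + y <? n
      ... | yes hx | yes hy = agree-left hx hy
      ... | _      | no  hy = agree-far (≮⇒≥ hy) x<n y<n
      ... | no  hx | yes _  = ≡⇔≡-flip (agree-far (≮⇒≥ hx) y<n x<n)

module _ {S P : Set} (_≟_ : DecidableEquality P) where

  periodic-difference : ∀ {s : ℕ → Letter S P} {m p d} {F G : P ↔ P} (D : List P) →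
    1 ≤ length D → p * (length D + 2) ≤ m → d < p → ParamsIn D s m →
    Shifted F p s s m → Shifted G (p + d) s s m → ∃[ H ] Shifted H d s s m
  periodic-difference {s} {m} {p} {d} {F} {G} D 1≤r bound d<p s∈D F-period G-period =
    map₂ (λ matches x d+x<m → matches x (+<⇒<∸ d+x<m)) (samePattern⇒matching _≟_ samePattern)
    where
      n : ℕ
      n = m ∸ d

      α-period : Shifted F p s s n
      α-period x h = F-period x (<-≤-trans h (m∸n≤m m d))

      β-period : Shifted F p (λ x → s (d + x)) (λ x → s (d + x)) n
      β-period x h = trans (F-period (d + x) (subst (_< m) (x∙yz≈y∙xz d p x) (<∸⇒+< {d} h)))
                           (cong s (sym (x∙yz≈y∙xz d p x)))

      αβ-shift : Shifted G p s (λ x → s (d + x)) n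
      αβ-shift x h = trans (G-period x (subst (_< m) (sym (xy∙z≈y∙xz p d x)) (<∸⇒+< {d} h)))
                           (cong s (xy∙z≈y∙xz p d x))

      bound′ : length D * p + p ≤ n
      bound′ = m+n≤o⇒m≤o∸n (r * p + p) (<⇒≤ (begin-strict
        r * p + p + d  <⟨ +-monoʳ-< (r * p + p) d<p ⟩
        r * p + p + p  ≡⟨ p*[r+2]≡r*p+p+p p r ⟨
        p * (r + 2)    ≤⟨ bound ⟩
        m              ∎))
        where
          open ≤-Reasoning
          r : ℕ
          r = length D
          p*[r+2]≡r*p+p+p : ∀ p r → p * (r + 2) ≡ r * p + p + p
          p*[r+2]≡r*p+p+p = solve-∀

      open CommonPeriod α-period β-period αβ-shift (λ x<n → s∈D (<-≤-trans x<n (m∸n≤m m d)))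
                        (s∈D ∘ <∸⇒+<) 1≤r bound′ using (samePattern)

  minimal-periods⇒2*p≤q : ∀ {s : ℕ → Letter S P} {m n p q} (D : List P) →
    1 ≤ length D → ParamsIn D s m → p * (length D + 2) ≤ m →
    MinimalPeriod s m p → MinimalPeriod s n q → p < q → 2 * p ≤ q
  minimal-periods⇒2*p≤q {s} {m} {n} {p} {q} D 1≤r s∈D bound
                        (p-periodic , p-minimal) (q-periodic , q-minimal) p<q =
    ≮⇒≥ λ q<2p → case n ≤? m of λ where
      (yes n≤m) → <⇒≱ p<q (q-minimal p (Periodic-restrict (<⇒≤ (<-≤-trans p<q q≤n)) n≤m p-periodic))
      (no  n≰m) → <⇒≱ (d<p q<2p) (p-minimal d (d-periodic q<2p (<⇒≤ (≰⇒> n≰m))))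
    where
      q≤n : q ≤ n
      q≤n = proj₁ (proj₂ q-periodic)

      d : ℕ
      d = q ∸ p

      p+d≡q : p + d ≡ q
      p+d≡q = m+[n∸m]≡n (<⇒≤ p<q)

      d<p : q < 2 * p → d < p
      d<p q<2p = +-cancelˡ-< p d p (subst₂ _<_ (sym p+d≡q) (cong (p +_) (+-identityʳ p)) q<2p)

      q≤m : q < 2 * p → q ≤ m
      q≤m q<2p = begin
        q                   ≤⟨ <⇒≤ q<2p ⟩
        2 * p               ≡⟨ *-comm 2 p ⟩
        p * 2               ≤⟨ *-monoʳ-≤ p (m≤n+m 2 (length D)) ⟩
        p * (length D + 2)  ≤⟨ bound ⟩
        m                   ∎
        where open ≤-Reasoning

      d-periodic : q < 2 * p → m ≤ n → Periodic s m d
      d-periodic q<2p m≤n with _ , _ , G , G-shifted ← Periodic-restrict (q≤m q<2p) m≤n q-periodic =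
        m<n⇒0<n∸m p<q , ≤-trans (m∸n≤m q p) (q≤m q<2p) ,
        periodic-difference D 1≤r bound (d<p q<2p) s∈D (proj₂ (proj₂ (proj₂ p-periodic)))
          (subst (λ k → Shifted G k s s m) (sym p+d≡q) G-shifted)

lemma10 : {S P : Set} (_≟_ : DecidableEquality P) (w : PString S P) (p q : ℕ) →
          HasParam w → p < q →
          IsPrefixPeriod _≟_ w p → IsPrefixPeriod _≟_ w q →
          2 * p ≤ q
lemma10                 _≟_ []        p q no-param = ⊥-elim (no-param refl)
lemma10 {P = P} _≟_ w@(a ∷ _) p q has-param p<q (m , m≤|w| , p-period , bound) (n , n≤|w| , q-period , _) =
  minimal-periods⇒2*p≤q _≟_ D 1≤|D|
    (λ x<m wx≡b → ∈-deduplicate⁺ _≟_ (∈-params w a (<-≤-trans x<m m≤|w|) wx≡b))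
    bound
    (PeriodIs-take⇒MinimalPeriod w a m≤|w| p-period)
    (PeriodIs-take⇒MinimalPeriod w a n≤|w| q-period)
    p<q
  where
    D : List P
    D = deduplicate _≟_ (params w)
    1≤|D| : 1 ≤ length D
    1≤|D| with params w
    ... | []    = ⊥-elim (has-param refl)
    ... | _ ∷ _ = s≤s z≤n
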